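{- Let $T$ be a finite tree and $P=p_0p_1\dots p_k$ a path in $T$ whose interior vertices $p_1,\dots,p_{k-1}$ all have degree two in $T$. Let $T'=KC(T,p_0,p_k)$, i.e. $T'$ is obtained from $T$ by deleting all edges between $p_k$ and $\Gamma(p_k)\setminus\{p_{k-1}\}$ and adding all edges between $p_0$ and $\Gamma(p_k)\setminus\{p_{k-1}\}$. Let $B$ be the vertex set of the component of $p_k$ in $T-E(P)$. If $k$ is even, then for every integer $\ell\ge 1$, \[\omega_{\ell}(p_0,T[B\cup P])-\omega_{\ell}(p_0,P)\leq \omega_{\ell}(p_0,T'[B\cup P])-\omega_{\ell}(p_0,P).\]
   Context: $\Gamma(v)$ is the set of neighbours of $v$ in $T$. For a graph $G$ and a vertex $x$, $\omega_\ell(x,G)$ is the number of walks of length $\ell$ in $G$ starting at $x$. $T[X]$ and $T'[X]$ denote the subgraphs of $T$ and $T'$ induced by the vertex set $X$; $P$ is regarded both as a path and as its vertex set. -}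

module Defs where

open import Data.Nat using (ℕ; zero; suc; _+_; _≤_; _<_)
open import Data.Fin using (Fin; zero; suc; toℕ; fromℕ; inject₁; _≟_)
open import Data.Bool using (Bool; true; false; _∧_; _∨_; not; if_then_else_)
open import Data.Product using (Σ; _×_; _,_)
open import Relation.Nullary using (¬_; does)
open import Relation.Binary.PropositionalEquality using (_≡_)
open import Function.Definitions using (Injective)

Adj : ℕ → Set
Adj n = Fin n → Fin n → Bool

SimpleGraph : ∀ {n} → Adj n → Set
SimpleGraph {n} G = (∀ x y → G x y ≡ G y x) × (∀ x → G x x ≡ false)

_==_ : ∀ {n} → Fin n → Fin n → Bool
x == y = does (x ≟ y)

sumFin : ∀ {n} → (Fin n → ℕ) → ℕ
sumFin {zero} f = 0
sumFin {suc n} f = f zero + sumFin (λ i → f (suc i))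

anyFin : ∀ {n} → (Fin n → Bool) → Bool
anyFin {zero} f = false
anyFin {suc n} f = f zero ∨ anyFin (λ i → f (suc i))

deg : ∀ {n} → Adj n → Fin n → ℕ
deg G x = sumFin (λ y → if G x y then 1 else 0)

-- ω ℓ x G : number of walks of length ℓ in G starting at x
ω : ∀ {n} → ℕ → Fin n → Adj n → ℕ
ω zero x G = 1
ω (suc ℓ) x G = sumFin (λ y → if G x y then ω ℓ y G else 0)

data Reach {n} (G : Adj n) : Fin n → Fin n → Set where
  here : ∀ {x} → Reach G x x
  step : ∀ {x y z} → G x y ≡ true → Reach G y z → Reach G x z

Connected : ∀ {n} → Adj n → Set
Connected G = ∀ x y → Reach G x y

HasCycle : ∀ {n} → Adj n → Set
HasCycle {n} G =
  Σ ℕ λ m → (2 ≤ m) × Σ (Fin (suc m) → Fin n) λ c →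
    Injective _≡_ _≡_ c ×
    (∀ (i : Fin m) → G (c (inject₁ i)) (c (suc i)) ≡ true) ×
    (G (c (fromℕ m)) (c zero) ≡ true)

IsTree : ∀ {n} → Adj n → Set
IsTree G = SimpleGraph G × Connected G × ¬ HasCycle G

IsPath : ∀ {n} (G : Adj n) (k : ℕ) → (Fin (suc k) → Fin n) → Set
IsPath G k p = Injective _≡_ _≡_ p × (∀ (i : Fin k) → G (p (inject₁ i)) (p (suc i)) ≡ true)

-- edge set E(P) of the path, as a graph (the path P itself as a graph)
pathEdge : ∀ {n} (k : ℕ) → (Fin (suc k) → Fin n) → Adj n
pathEdge k p x y = anyFin (λ (i : Fin k) →
  ((x == p (inject₁ i)) ∧ (y == p (suc i))) ∨ ((y == p (inject₁ i)) ∧ (x == p (suc i))))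

inPath : ∀ {n} (k : ℕ) → (Fin (suc k) → Fin n) → Fin n → Bool
inPath k p x = anyFin (λ (i : Fin (suc k)) → x == p i)

deleteEdges : ∀ {n} → Adj n → Adj n → Adj n
deleteEdges G H x y = G x y ∧ not (H x y)

induced : ∀ {n} → Adj n → (Fin n → Bool) → Adj n
induced G S x y = G x y ∧ S x ∧ S y

-- KC(T, a, b) with c = the path neighbour of b (p_{k-1}):
-- delete all edges b–w, add all edges a–w, for w ∈ Γ(b) \ {c}
KC : ∀ {n} → Adj n → (a b c : Fin n) → Adj n
KC G a b c x y =
  (G x y ∧ not (((x == b) ∧ N y) ∨ ((y == b) ∧ N x))) ∨ (((x == a) ∧ N y) ∨ ((y == a) ∧ N x))
  where
  N : _ → Bool
  N w = G b w ∧ not (w == c)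

module Submission where

-- Write k = j + 1, a = p₀, b = p_k, c = p_{k-1}, S = B ∪ P,
-- X = T[S], Y = T'[S] with T' = KC(T,a,b), and N = Γ(b) ∖ {c}.  Since both
-- sides subtract ω_ℓ(p₀,P), it suffices to show ω_ℓ(a,X) ≤ ω_ℓ(a,Y).
-- Degree two keeps the interior of P out of B, acyclicity keeps a out of B,
-- so N ⊆ B and B ∖ {b} is closed under T-neighbours.  Therefore in X: a sees
-- only p₁, p_i (0<i<k) sees p_{i±1}, b sees {c} ∪ N, x ∈ B ∖ {b} sees its
-- T-neighbours; in Y the set N is moved from b to a.  Reversing the path
-- (pᵢ ↦ p_{k-i}, B ∖ {b} fixed) thus maps X onto Y, which we use on walk
-- counts (lemma mirror, by induction on ℓ):
--   ω_ℓ(x,X) = ω_ℓ(x,Y) for x ∈ B ∖ {b},   ω_ℓ(pᵢ,X) = ω_ℓ(p_{k-i},Y).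
-- For k = 2q we then show ω_ℓ(pᵢ,X) ≤ ω_ℓ(pᵢ,Y) for i ≤ q by induction on ℓ
-- (lemma ωX≤ωY): at i = q it is the mirror identity, for 0 < i < q it follows
-- from the two path neighbours, and at i = 0 from
-- ω_{ℓ+1}(a,Y) = ω_ℓ(p₁,Y) + Σ_{w∈N} ω_ℓ(w,Y).

open import Defs
open import Data.Nat using (ℕ; zero; suc; _+_; _≤_; _<_; z≤n; s≤s; s≤s⁻¹)
open import Data.Nat.Properties
  using (≤-refl; ≤-trans; ≤-reflexive; <⇒≤; n≤1+n; m≤m+n; m<m+n; +-mono-≤;
         +-comm; +-suc; +-identityʳ; *-comm; suc-injective; <-irrefl; m≤n⇒m<n∨m≡n;
         module ≤-Reasoning)
open import Data.Nat.Divisibility using (_∣_; divides; ∣1⇒≡1)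
open import Data.Nat.Solver using (module +-*-Solver)
open import Data.Fin using (Fin; zero; suc; toℕ; fromℕ; fromℕ<; inject₁; _≟_)
open import Data.Fin.Properties using (toℕ-fromℕ<; toℕ-fromℕ; toℕ<n; any?)
open import Data.Bool using (Bool; true; false; _∧_; _∨_; not; if_then_else_)
open import Data.Bool.Properties using (∨-comm; ∧-zeroʳ)
open import Data.Product using (Σ; _×_; _,_; proj₁; proj₂)
open import Data.Sum using (_⊎_; inj₁; inj₂)
open import Data.Empty using (⊥; ⊥-elim)
open import Data.Vec using (Vec; []; _∷_; lookup)
open import Data.Integer using (+_; _-_; -_; +≤+) renaming (_≤_ to _≤ℤ_)
import Data.Integer.Properties as ℤ
open import Relation.Nullary using (yes; no)
open import Relation.Nullary.Decidable using (dec-true; dec-false)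
open import Relation.Binary.PropositionalEquality
  using (_≡_; _≢_; refl; sym; trans; cong; cong₂; subst; subst₂; module ≡-Reasoning)
open import Function.Bundles using (_⇔_; Equivalence)
open import Function.Definitions using (Injective)

∧-split : ∀ {u v} → u ∧ v ≡ true → u ≡ true × v ≡ true
∧-split {true} {true} _ = refl , refl

∧-intro : ∀ {u v} → u ≡ true → v ≡ true → u ∧ v ≡ true
∧-intro refl refl = refl

∨-split : ∀ {u v} → u ∨ v ≡ true → u ≡ true ⊎ v ≡ true
∨-split {true}  _ = inj₁ refl
∨-split {false} e = inj₂ e

∨-introˡ : ∀ {u} v → u ≡ true → u ∨ v ≡ true
∨-introˡ v refl = refl

∨-introʳ : ∀ u {v} → v ≡ true → u ∨ v ≡ true
∨-introʳ true  refl = refl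
∨-introʳ false refl = refl

∨-false-split : ∀ {u v} → u ∨ v ≡ false → u ≡ false × v ≡ false
∨-false-split {false} {false} _ = refl , refl

∨-false-intro : ∀ {u v} → u ≡ false → v ≡ false → u ∨ v ≡ false
∨-false-intro refl refl = refl

not-true : ∀ {u} → not u ≡ true → u ≡ false
not-true {false} _ = refl

not-false : ∀ {u} → not u ≡ false → u ≡ true
not-false {true} _ = refl

not-intro : ∀ {u} → u ≡ false → not u ≡ true
not-intro refl = refl

true≢false : ∀ {u} → u ≡ true → u ≡ false → ⊥
true≢false refl ()

bool-ext : ∀ {u v} → (u ≡ true → v ≡ true) → (v ≡ true → u ≡ true) → u ≡ v
bool-ext {true}  {true}  _ _ = refl
bool-ext {true}  {false} f _ = sym (f refl)
bool-ext {false} {true}  _ g = g refl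
bool-ext {false} {false} _ _ = refl

by-cases : ∀ {A : Set} u → (u ≡ false → A) → (u ≡ true → A) → A
by-cases false f _ = f refl
by-cases true  _ t = t refl

module _ {n : ℕ} where

  ==-refl : (x : Fin n) → (x == x) ≡ true
  ==-refl x = dec-true (x ≟ x) refl

  ≡⇒== : {x y : Fin n} → x ≡ y → (x == y) ≡ true
  ≡⇒== {x} refl = ==-refl x

  ==⇒≡ : {x y : Fin n} → (x == y) ≡ true → x ≡ y
  ==⇒≡ {x} {y} e with x ≟ y
  ... | yes x≡y = x≡y

  ≢⇒== : {x y : Fin n} → x ≢ y → (x == y) ≡ false
  ≢⇒== {x} {y} = dec-false (x ≟ y)

  guard-false : (x y : Fin n) {M : Bool} → (x ≡ y → M ≡ false) → ((x == y) ∧ M) ≡ false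
  guard-false x y f with x ≟ y
  ... | yes x≡y = f x≡y
  ... | no  _   = refl

  guard-false⁻ : (x y : Fin n) {M : Bool} → ((x == y) ∧ M) ≡ false → x ≡ y → M ≡ false
  guard-false⁻ x _ e refl rewrite ==-refl x = e

  guard-true : (x y : Fin n) {M : Bool} → ((x == y) ∧ M) ≡ true → x ≡ y × M ≡ true
  guard-true _ _ e = ==⇒≡ (proj₁ (∧-split e)) , proj₂ (∧-split e)

anyFin-witness : ∀ {m} (f : Fin m → Bool) → anyFin f ≡ true → Σ (Fin m) λ i → f i ≡ true
anyFin-witness {suc m} f e with ∨-split {f zero} e
... | inj₁ e₀ = zero , e₀
... | inj₂ eₛ with anyFin-witness (λ i → f (suc i)) eₛ
...   | i , eᵢ = suc i , eᵢ

anyFin-intro : ∀ {m} (f : Fin m → Bool) (i : Fin m) → f i ≡ true → anyFin f ≡ true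
anyFin-intro {suc m} f zero    e = ∨-introˡ _ e
anyFin-intro {suc m} f (suc i) e = ∨-introʳ (f zero) (anyFin-intro (λ i → f (suc i)) i e)

anyFin-cong : ∀ {m} {f g : Fin m → Bool} → (∀ i → f i ≡ g i) → anyFin f ≡ anyFin g
anyFin-cong {zero}  eq = refl
anyFin-cong {suc m} eq = cong₂ _∨_ (eq zero) (anyFin-cong (λ i → eq (suc i)))

sumFin-cong : ∀ {n} {f g : Fin n → ℕ} → (∀ i → f i ≡ g i) → sumFin f ≡ sumFin g
sumFin-cong {zero}  eq = refl
sumFin-cong {suc n} eq = cong₂ _+_ (eq zero) (sumFin-cong (λ i → eq (suc i)))

sumFin-+ : ∀ {n} (f g : Fin n → ℕ) → sumFin (λ i → f i + g i) ≡ sumFin f + sumFin g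
sumFin-+ {zero}  f g = refl
sumFin-+ {suc n} f g =
  trans (cong (λ t → f zero + g zero + t) (sumFin-+ (λ i → f (suc i)) (λ i → g (suc i))))
        (interchange (f zero) (g zero) _ _)
  where
  open +-*-Solver
  interchange : ∀ a b c d → a + b + (c + d) ≡ a + c + (b + d)
  interchange = solve 4 (λ a b c d → a :+ b :+ (c :+ d) := a :+ c :+ (b :+ d)) refl

sumFin-zero : ∀ {n} (f : Fin n → ℕ) → (∀ i → f i ≡ 0) → sumFin f ≡ 0
sumFin-zero {zero}  f eq = refl
sumFin-zero {suc n} f eq rewrite eq zero = sumFin-zero (λ i → f (suc i)) (λ i → eq (suc i))

sumFin-point : ∀ {n} (a : Fin n) (c : ℕ) → sumFin (λ y → if y == a then c else 0) ≡ c
sumFin-point {suc n} zero c =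
  trans (cong (λ t → c + t) (sumFin-zero {n} (λ y → if suc y == zero then c else 0) (λ _ → refl)))
        (+-identityʳ c)
sumFin-point {suc n} (suc a) c = sumFin-point a c

module _ {n : ℕ} where

  sumOver : (Fin n → Bool) → (Fin n → ℕ) → ℕ
  sumOver S f = sumFin (λ y → if S y then f y else 0)

  _─_ : (Fin n → Bool) → Fin n → Fin n → Bool
  (S ─ a) y = S y ∧ not (y == a)

  sumOver-cong : {S S' : Fin n → Bool} {f f' : Fin n → ℕ} → (∀ y → S y ≡ S' y) →
    (∀ y → S y ≡ true → f y ≡ f' y) → sumOver S f ≡ sumOver S' f'
  sumOver-cong {S} {S'} {f} {f'} eqS eqf = sumFin-cong pointwise
    where
    pointwise : ∀ y → (if S y then f y else 0) ≡ (if S' y then f' y else 0)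
    pointwise y rewrite sym (eqS y) with S y in e
    ... | true  = eqf y e
    ... | false = refl

  sumOver-empty : {S : Fin n → Bool} (f : Fin n → ℕ) → (∀ y → S y ≡ false) → sumOver S f ≡ 0
  sumOver-empty {S} f empty = sumFin-zero _ (λ y → cong (λ u → if u then f y else 0) (empty y))

  sumOver-remove : {S : Fin n → Bool} (f : Fin n → ℕ) (a : Fin n) → S a ≡ true →
    sumOver S f ≡ f a + sumOver (S ─ a) f
  sumOver-remove {S} f a Sa = begin
    sumOver S f                                          ≡⟨ sumFin-cong split ⟩
    sumFin (λ y → (if y == a then f y else 0) + (if (S ─ a) y then f y else 0))
      ≡⟨ sumFin-+ (λ y → if y == a then f y else 0) (λ y → if (S ─ a) y then f y else 0) ⟩
    sumFin (λ y → if y == a then f y else 0) + sumOver (S ─ a) f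
      ≡⟨ cong (_+ sumOver (S ─ a) f) (trans (sumFin-cong at-a) (sumFin-point a (f a))) ⟩
    f a + sumOver (S ─ a) f                              ∎
    where
    open ≡-Reasoning
    split : ∀ y → (if S y then f y else 0) ≡
                  (if y == a then f y else 0) + (if (S ─ a) y then f y else 0)
    split y with y ≟ a | S y in Sy
    ... | yes refl | true  = sym (+-identityʳ (f y))
    ... | yes refl | false = ⊥-elim (true≢false Sa Sy)
    ... | no  _    | true  = refl
    ... | no  _    | false = refl
    at-a : ∀ y → (if y == a then f y else 0) ≡ (if y == a then f a else 0)
    at-a y with y ≟ a
    ... | yes refl = refl
    ... | no  _    = refl

  sumOver-≥ : {S : Fin n → Bool} (f : Fin n → ℕ) (a : Fin n) → S a ≡ true → f a ≤ sumOver S f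
  sumOver-≥ f a Sa = subst (f a ≤_) (sym (sumOver-remove f a Sa)) (m≤m+n _ _)

  sumOver-singleton : {S : Fin n → Bool} (f : Fin n → ℕ) (a : Fin n) → S a ≡ true →
    (∀ y → S y ≡ true → y ≡ a) → sumOver S f ≡ f a
  sumOver-singleton {S} f a Sa only-a =
    trans (sumOver-remove f a Sa)
          (trans (cong (λ t → f a + t) (sumOver-empty f rest-empty)) (+-identityʳ (f a)))
    where
    rest-empty : ∀ y → (S ─ a) y ≡ false
    rest-empty y with S y in Sy
    ... | false = refl
    ... | true rewrite only-a y Sy | ==-refl a = refl

  sumOver-pair : {S : Fin n → Bool} (f : Fin n → ℕ) (a a' : Fin n) → a ≢ a' →
    S a ≡ true → S a' ≡ true → (∀ y → S y ≡ true → y ≡ a ⊎ y ≡ a') →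
    sumOver S f ≡ f a + f a'
  sumOver-pair {S} f a a' a≢a' Sa Sa' only =
    trans (sumOver-remove f a Sa) (cong (λ t → f a + t) (sumOver-singleton f a' Sa'-rest only-a'))
    where
    Sa'-rest : (S ─ a) a' ≡ true
    Sa'-rest = ∧-intro Sa' (not-intro (≢⇒== (λ e → a≢a' (sym e))))
    only-a' : ∀ y → (S ─ a) y ≡ true → y ≡ a'
    only-a' y e with ∧-split e
    ... | Sy , y≢a with only y Sy
    ...   | inj₁ refl = ⊥-elim (true≢false (==-refl y) (not-true y≢a))
    ...   | inj₂ y≡a' = y≡a'

degree-two-neighbours : ∀ {n} (G : Adj n) {x u v w : Fin n} → deg G x ≡ 2 →
  G x u ≡ true → G x v ≡ true → u ≢ v → G x w ≡ true → w ≡ u ⊎ w ≡ v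
degree-two-neighbours G {x} {u} {v} {w} deg2 Gu Gv u≢v Gw with w ≟ u | w ≟ v
... | yes w≡u | _       = inj₁ w≡u
... | no  _   | yes w≡v = inj₂ w≡v
... | no  w≢u | no  w≢v = ⊥-elim (<-irrefl refl (subst (2 <_) deg2 three≤deg))
  where
  one : Fin _ → ℕ
  one _ = 1
  Gv' : (G x ─ u) v ≡ true
  Gv' = ∧-intro Gv (not-intro (≢⇒== (λ e → u≢v (sym e))))
  Gw' : ((G x ─ u) ─ v) w ≡ true
  Gw' = ∧-intro (∧-intro Gw (not-intro (≢⇒== w≢u))) (not-intro (≢⇒== w≢v))
  three≤deg : 3 ≤ deg G x
  three≤deg = subst (3 ≤_) (sym (trans (sumOver-remove one u Gu)
                                       (cong suc (sumOver-remove one v Gv'))))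
                    (s≤s (s≤s (sumOver-≥ one w Gw')))

module _ {n : ℕ} where

  reach-snoc : {G : Adj n} {x y z : Fin n} → Reach G x y → G y z ≡ true → Reach G x z
  reach-snoc here       e' = step e' here
  reach-snoc (step e r) e' = step e (reach-snoc r e')

  reach-trans : {G : Adj n} {x y z : Fin n} → Reach G x y → Reach G y z → Reach G x z
  reach-trans here       r' = r'
  reach-trans (step e r) r' = step e (reach-trans r r')

  reach-mono : {G G' : Adj n} → (∀ u v → G u v ≡ true → G' u v ≡ true) →
    {x y : Fin n} → Reach G x y → Reach G' x y
  reach-mono G⊆G' here       = here
  reach-mono G⊆G' (step e r) = step (G⊆G' _ _ e) (reach-mono G⊆G' r)

  reach-last : {G : Adj n} {x z : Fin n} → Reach G x z →
    x ≡ z ⊎ Σ (Fin n) (λ y → Reach G x y × G y z ≡ true)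
  reach-last here = inj₁ refl
  reach-last (step e r) with reach-last r
  ... | inj₁ refl          = inj₂ (_ , here , e)
  ... | inj₂ (y , r' , e') = inj₂ (y , step e r' , e')

  data SimplePath (H : Adj n) : Fin n → Fin n → (m : ℕ) → Vec (Fin n) (suc m) → Set where
    single : ∀ {x} → SimplePath H x x 0 (x ∷ [])
    cons   : ∀ {y z x m vs} → H y z ≡ true → (∀ i → lookup vs i ≢ y) →
             SimplePath H z x m vs → SimplePath H y x (suc m) (y ∷ vs)

  SomeSimplePath : Adj n → Fin n → Fin n → Set
  SomeSimplePath H y x = Σ ℕ λ m → Σ (Vec (Fin n) (suc m)) λ vs → SimplePath H y x m vs

  simplePath-suffix : {H : Adj n} {z x : Fin n} {m : ℕ} {vs : Vec (Fin n) (suc m)} →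
    SimplePath H z x m vs → (i : Fin (suc m)) → SomeSimplePath H (lookup vs i) x
  simplePath-suffix single         zero    = _ , _ , single
  simplePath-suffix (cons e fresh π) zero  = _ , _ , cons e fresh π
  simplePath-suffix (cons e fresh π) (suc i) = simplePath-suffix π i

  -- Every walk can be shortened to a simple path (cut at the first repetition).
  simplePath-from-reach : {H : Adj n} {y x : Fin n} → Reach H y x → SomeSimplePath H y x
  simplePath-from-reach here = _ , _ , single
  simplePath-from-reach {y = y} (step e r) with simplePath-from-reach r
  ... | m , vs , π with any? (λ i → lookup vs i ≟ y)
  ...   | yes (i , vsᵢ≡y) = subst (λ w → SomeSimplePath _ w _) vsᵢ≡y (simplePath-suffix π i)
  ...   | no  fresh       = _ , _ , cons e (λ i e' → fresh (i , e')) π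

  simplePath-head : {H : Adj n} {y x : Fin n} {m : ℕ} {vs : Vec (Fin n) (suc m)} →
    SimplePath H y x m vs → lookup vs zero ≡ y
  simplePath-head single       = refl
  simplePath-head (cons _ _ _) = refl

  simplePath-last : {H : Adj n} {y x : Fin n} {m : ℕ} {vs : Vec (Fin n) (suc m)} →
    SimplePath H y x m vs → lookup vs (fromℕ m) ≡ x
  simplePath-last single       = refl
  simplePath-last (cons _ _ π) = simplePath-last π

  simplePath-edge : {H : Adj n} {y x : Fin n} {m : ℕ} {vs : Vec (Fin n) (suc m)} →
    SimplePath H y x m vs → (i : Fin m) → H (lookup vs (inject₁ i)) (lookup vs (suc i)) ≡ true
  simplePath-edge (cons e _ π) zero rewrite simplePath-head π = e
  simplePath-edge (cons _ _ π) (suc i) = simplePath-edge π i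

  simplePath-injective : {H : Adj n} {y x : Fin n} {m : ℕ} {vs : Vec (Fin n) (suc m)} →
    SimplePath H y x m vs → Injective _≡_ _≡_ (lookup vs)
  simplePath-injective single           {zero}  {zero}  _ = refl
  simplePath-injective (cons _ _     _) {zero}  {zero}  _ = refl
  simplePath-injective (cons _ fresh _) {zero}  {suc j} e = ⊥-elim (fresh j (sym e))
  simplePath-injective (cons _ fresh _) {suc i} {zero}  e = ⊥-elim (fresh i e)
  simplePath-injective (cons _ _     π) {suc i} {suc j} e = cong suc (simplePath-injective π e)

  closing-edge⇒cycle : (T : Adj n) → SimpleGraph T → (H : Adj n) →
    (∀ u v → H u v ≡ true → T u v ≡ true) → (x y : Fin n) →
    T x y ≡ true → H y x ≡ false → Reach H y x → HasCycle T
  closing-edge⇒cycle T (_ , loopless) H H⊆T x y Txy Hyx r with simplePath-from-reach r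
  ... | zero , _ , single rewrite loopless x = ⊥-elim (true≢false Txy refl)
  ... | suc zero , _ , cons Hyx' _ single = ⊥-elim (true≢false Hyx' Hyx)
  ... | suc (suc m) , vs , π =
    suc (suc m) , s≤s (s≤s z≤n) , lookup vs , simplePath-injective π ,
    (λ i → H⊆T _ _ (simplePath-edge π i)) , closing
    where
    closing : T (lookup vs (fromℕ (suc (suc m)))) (lookup vs zero) ≡ true
    closing rewrite simplePath-last π | simplePath-head π = Txy

-- Indexing a path p : Fin (suc k) → Fin n by natural numbers: clamp k m is m
-- viewed in Fin (suc k) when m ≤ k.

clamp : (k m : ℕ) → Fin (suc k)
clamp zero    m       = zero
clamp (suc k) zero    = zero
clamp (suc k) (suc m) = suc (clamp k m)

toℕ-clamp : ∀ k m → m ≤ k → toℕ (clamp k m) ≡ m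
toℕ-clamp zero    zero    _         = refl
toℕ-clamp (suc k) zero    _         = refl
toℕ-clamp (suc k) (suc m) (s≤s m≤k) = cong suc (toℕ-clamp k m m≤k)

clamp-toℕ : ∀ k (i : Fin (suc k)) → clamp k (toℕ i) ≡ i
clamp-toℕ zero    zero    = refl
clamp-toℕ (suc k) zero    = refl
clamp-toℕ (suc k) (suc i) = cong suc (clamp-toℕ k i)

clamp-fromℕ : ∀ k → clamp k k ≡ fromℕ k
clamp-fromℕ zero    = refl
clamp-fromℕ (suc k) = cong suc (clamp-fromℕ k)

clamp-inject₁ : ∀ k (i : Fin k) → clamp k (toℕ i) ≡ inject₁ i
clamp-inject₁ (suc k) zero    = refl
clamp-inject₁ (suc k) (suc i) = cong suc (clamp-inject₁ k i)

clamp-suc : ∀ k (i : Fin k) → clamp k (suc (toℕ i)) ≡ suc i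
clamp-suc (suc k) zero    = cong suc (clamp-toℕ k zero)
clamp-suc (suc k) (suc i) = cong suc (clamp-suc k i)

module Configuration {n : ℕ} (T : Adj n) (tree : IsTree T) (j : ℕ)
  (p : Fin (suc (suc j)) → Fin n) (isPath : IsPath T (suc j) p)
  (interior-deg : ∀ (i : Fin (suc (suc j))) → 1 ≤ toℕ i → toℕ i < suc j → deg T (p i) ≡ 2)
  (B : Fin n → Bool)
  (B-def : ∀ x → (B x ≡ true) ⇔
                 Reach (deleteEdges T (pathEdge (suc j) p)) (p (fromℕ (suc j))) x)
  (1≤j : 1 ≤ j) where

  k : ℕ
  k = suc j

  p[_] : ℕ → Fin n
  p[ m ] = p (clamp k m)

  a b c : Fin n
  a = p[ 0 ]
  b = p[ k ]
  c = p[ j ]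

  T-sym : ∀ x y → T x y ≡ T y x
  T-sym = proj₁ (proj₁ tree)

  T-loopless : ∀ x → T x x ≡ false
  T-loopless = proj₂ (proj₁ tree)

  T-sym-edge : ∀ {x y} → T x y ≡ true → T y x ≡ true
  T-sym-edge {x} {y} e = trans (T-sym y x) e

  p[]-injective : ∀ {m m'} → m ≤ k → m' ≤ k → p[ m ] ≡ p[ m' ] → m ≡ m'
  p[]-injective {m} {m'} m≤k m'≤k e =
    trans (sym (toℕ-clamp k m m≤k)) (trans (cong toℕ (proj₁ isPath e)) (toℕ-clamp k m' m'≤k))

  p[]≢a : ∀ {m} → 1 ≤ m → m ≤ k → p[ m ] ≢ a
  p[]≢a {suc m} _ m≤k e with p[]-injective m≤k z≤n e
  ... | ()

  a≢b : a ≢ b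
  a≢b e = p[]≢a (s≤s z≤n) ≤-refl (sym e)

  p[]-clamp : ∀ {m} (m<k : m < k) →
    p (inject₁ (fromℕ< m<k)) ≡ p[ m ] × p (suc (fromℕ< m<k)) ≡ p[ suc m ]
  p[]-clamp {m} m<k =
      cong p (trans (sym (clamp-inject₁ k i)) (cong (clamp k) (toℕ-fromℕ< m<k)))
    , cong p (trans (sym (clamp-suc k i)) (cong (λ t → clamp k (suc t)) (toℕ-fromℕ< m<k)))
    where
    i = fromℕ< m<k

  path-edge : ∀ {m} → m < k → T p[ m ] p[ suc m ] ≡ true
  path-edge m<k with p[]-clamp m<k
  ... | e₁ , e₂ = subst₂ (λ u v → T u v ≡ true) e₁ e₂ (proj₂ isPath (fromℕ< m<k))

  path-edge˘ : ∀ {m} → m < k → T p[ suc m ] p[ m ] ≡ true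
  path-edge˘ m<k = T-sym-edge (path-edge m<k)

  PE : Adj n
  PE = pathEdge k p

  edgeAt : Fin n → Fin n → Fin k → Bool
  edgeAt x y i = ((x == p (inject₁ i)) ∧ (y == p (suc i))) ∨ ((y == p (inject₁ i)) ∧ (x == p (suc i)))

  PE-sym : ∀ x y → PE x y ≡ PE y x
  PE-sym x y = anyFin-cong (λ i → ∨-comm ((x == p (inject₁ i)) ∧ (y == p (suc i)))
                                         ((y == p (inject₁ i)) ∧ (x == p (suc i))))

  PE-split : ∀ {x y} → PE x y ≡ true → Σ ℕ λ m → m < k ×
    ((x ≡ p[ m ] × y ≡ p[ suc m ]) ⊎ (y ≡ p[ m ] × x ≡ p[ suc m ]))
  PE-split {x} {y} e with anyFin-witness (edgeAt x y) e
  ... | i , eᵢ = toℕ i , toℕ<n i , oriented (∨-split eᵢ)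
    where
    at-i : p (inject₁ i) ≡ p[ toℕ i ]
    at-i = cong p (sym (clamp-inject₁ k i))
    after-i : p (suc i) ≡ p[ suc (toℕ i) ]
    after-i = cong p (sym (clamp-suc k i))
    oriented : ∀ {u v : Fin n} → ((u == p (inject₁ i)) ∧ (v == p (suc i))) ≡ true ⊎
                                  ((v == p (inject₁ i)) ∧ (u == p (suc i))) ≡ true →
      (u ≡ p[ toℕ i ] × v ≡ p[ suc (toℕ i) ]) ⊎ (v ≡ p[ toℕ i ] × u ≡ p[ suc (toℕ i) ])
    oriented (inj₁ e') = inj₁ (trans (==⇒≡ (proj₁ (∧-split e'))) at-i ,
                               trans (==⇒≡ (proj₂ (∧-split e'))) after-i)
    oriented (inj₂ e') = inj₂ (trans (==⇒≡ (proj₁ (∧-split e'))) at-i ,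
                               trans (==⇒≡ (proj₂ (∧-split e'))) after-i)

  PE-path : ∀ {m} → m < k → PE p[ m ] p[ suc m ] ≡ true
  PE-path {m} m<k with p[]-clamp m<k
  ... | e₁ , e₂ = anyFin-intro (edgeAt p[ m ] p[ suc m ]) (fromℕ< m<k)
                    (∨-introˡ _ (∧-intro (≡⇒== (sym e₁)) (≡⇒== (sym e₂))))

  PE-path˘ : ∀ {m} → m < k → PE p[ suc m ] p[ m ] ≡ true
  PE-path˘ {m} m<k = trans (PE-sym p[ suc m ] p[ m ]) (PE-path m<k)

  PE-at : ∀ {m w} → m ≤ k → PE p[ m ] w ≡ true →
    (w ≡ p[ suc m ] × m < k) ⊎ Σ ℕ (λ m' → m ≡ suc m' × w ≡ p[ m' ])
  PE-at m≤k e with PE-split e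
  ... | m' , m'<k , inj₁ (e₁ , e₂) with p[]-injective m≤k (<⇒≤ m'<k) e₁
  ...   | refl = inj₁ (e₂ , m'<k)
  PE-at m≤k e | m' , m'<k , inj₂ (e₁ , e₂) with p[]-injective m≤k m'<k e₂
  ...   | refl = inj₂ (m' , refl , e₁)

  PE-at-b : ∀ {w} → PE b w ≡ true → w ≡ c
  PE-at-b e with PE-at ≤-refl e
  ... | inj₁ (_ , k<k) = ⊥-elim (<-irrefl refl k<k)
  ... | inj₂ (m' , k≡1+m' , w≡) rewrite suc-injective k≡1+m' = w≡

  inPath-split : ∀ {x} → inPath k p x ≡ true → Σ ℕ λ m → m ≤ k × x ≡ p[ m ]
  inPath-split {x} e with anyFin-witness (λ i → x == p i) e
  ... | i , eᵢ = toℕ i , s≤s⁻¹ (toℕ<n i) , trans (==⇒≡ eᵢ) (cong p (sym (clamp-toℕ k i)))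

  inPath-path : ∀ m → inPath k p p[ m ] ≡ true
  inPath-path m = anyFin-intro (λ i → p[ m ] == p i) (clamp k m) (==-refl p[ m ])

  interior-neighbours : ∀ {m y} → suc m < k → T p[ suc m ] y ≡ true →
    y ≡ p[ m ] ⊎ y ≡ p[ suc (suc m) ]
  interior-neighbours {m} m+1<k =
    degree-two-neighbours T (interior-deg (clamp k (suc m)) 1≤m+1 m+1<k')
      (path-edge˘ (≤-trans (n≤1+n _) m+1<k)) (path-edge m+1<k) distinct
    where
    index = toℕ-clamp k (suc m) (<⇒≤ m+1<k)
    1≤m+1 : 1 ≤ toℕ (clamp k (suc m))
    1≤m+1 = subst (1 ≤_) (sym index) (s≤s z≤n)
    m+1<k' : toℕ (clamp k (suc m)) < k
    m+1<k' = subst (_< k) (sym index) m+1<k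
    distinct : p[ m ] ≢ p[ suc (suc m) ]
    distinct e with p[]-injective (≤-trans (n≤1+n m) (<⇒≤ m+1<k)) m+1<k e
    ... | ()

  H : Adj n
  H = deleteEdges T PE

  H-intro : ∀ {x y} → T x y ≡ true → PE x y ≡ false → H x y ≡ true
  H-intro Txy PExy = ∧-intro Txy (not-intro PExy)

  H-split : ∀ {x y} → H x y ≡ true → T x y ≡ true × PE x y ≡ false
  H-split e = proj₁ (∧-split e) , not-true (proj₂ (∧-split e))

  B⇒reach : ∀ {x} → B x ≡ true → Reach H b x
  B⇒reach {x} Bx = subst (λ w → Reach H w x) (cong p (sym (clamp-fromℕ k))) (Equivalence.to (B-def x) Bx)

  reach⇒B : ∀ {x} → Reach H b x → B x ≡ true
  reach⇒B {x} r = Equivalence.from (B-def x) (subst (λ w → Reach H w x) (cong p (clamp-fromℕ k)) r)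

  -- An interior path vertex is not in B: both of its T-edges lie on P.
  interior∉B : ∀ {m} → 1 ≤ m → m < k → B p[ m ] ≡ false
  interior∉B {suc m} _ m+1<k =
    by-cases (B p[ suc m ]) (λ e → e) (λ B≡ → ⊥-elim (unreachable (reach-last (B⇒reach B≡))))
    where
    unreachable : b ≡ p[ suc m ] ⊎ Σ (Fin n) (λ z → Reach H b z × H z p[ suc m ] ≡ true) → ⊥
    unreachable (inj₁ b≡) = <-irrefl (sym (p[]-injective ≤-refl (<⇒≤ m+1<k) b≡)) m+1<k
    unreachable (inj₂ (z , _ , Hz)) with H-split Hz
    ... | Tz , PEz with interior-neighbours m+1<k (T-sym-edge Tz)
    ...   | inj₁ refl = true≢false (PE-path (≤-trans (n≤1+n _) m+1<k)) PEz
    ...   | inj₂ refl = true≢false (PE-path˘ m+1<k) PEz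

  c∉B : B c ≡ false
  c∉B = interior∉B 1≤j ≤-refl

  T-minus-first : Adj n
  T-minus-first u v = T u v ∧ not (((u == a) ∧ (v == p[ 1 ])) ∨ ((u == p[ 1 ]) ∧ (v == a)))

  T-minus-first-intro : ∀ {u v} → T u v ≡ true → u ≢ a → v ≢ a → T-minus-first u v ≡ true
  T-minus-first-intro {u} Tuv u≢a v≢a =
    ∧-intro Tuv (not-intro (∨-false-intro (guard-false u a (λ e → ⊥-elim (u≢a e)))
                                          (guard-false u p[ 1 ] (λ _ → ≢⇒== v≢a))))

  H⊆T-minus-first : ∀ u v → H u v ≡ true → T-minus-first u v ≡ true
  H⊆T-minus-first u v Huv with H-split Huv
  ... | Tuv , PEuv = ∧-intro Tuv (not-intro (∨-false-intro (guard-false u a first) (guard-false u p[ 1 ] first˘)))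
    where
    first : u ≡ a → (v == p[ 1 ]) ≡ false
    first refl = ≢⇒== {x = v} (λ { refl → true≢false (PE-path (s≤s z≤n)) PEuv })
    first˘ : u ≡ p[ 1 ] → (v == a) ≡ false
    first˘ refl = ≢⇒== {x = v} (λ { refl → true≢false (PE-path˘ (s≤s z≤n)) PEuv })

  walk-along-path : ∀ m → 1 ≤ m → m ≤ k → Reach T-minus-first p[ 1 ] p[ m ]
  walk-along-path (suc zero)       _ _   = here
  walk-along-path (suc (suc m)) _ m+2≤k =
    reach-snoc (walk-along-path (suc m) (s≤s z≤n) m+1≤k)
               (T-minus-first-intro (path-edge m+2≤k) (p[]≢a (s≤s z≤n) m+1≤k) (p[]≢a (s≤s z≤n) m+2≤k))
    where
    m+1≤k = ≤-trans (n≤1+n _) m+2≤k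

  -- a ∉ B: otherwise p₁ → … → b → … → a avoids the edge p₀p₁ and closes a cycle.
  a∉B : B a ≡ false
  a∉B = by-cases (B a) (λ e → e) (λ Ba → ⊥-elim (proj₂ (proj₂ tree) (cycle Ba)))
    where
    p₁a-removed : T-minus-first p[ 1 ] a ≡ false
    p₁a-removed rewrite ==-refl p[ 1 ] | ==-refl a | ∨-comm ((p[ 1 ] == a) ∧ (a == p[ 1 ])) true
      = ∧-zeroʳ (T p[ 1 ] a)
    cycle : B a ≡ true → HasCycle T
    cycle Ba = closing-edge⇒cycle T (proj₁ tree) T-minus-first (λ _ _ e → proj₁ (∧-split e))
                 a p[ 1 ] (path-edge (s≤s z≤n)) p₁a-removed
                 (reach-trans (walk-along-path k (s≤s z≤n) ≤-refl)
                              (reach-mono H⊆T-minus-first (B⇒reach Ba)))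

  B-off-path : ∀ {x} → B x ≡ true → x ≢ b → ∀ {m} → m ≤ k → x ≢ p[ m ]
  B-off-path Bx x≢b {zero} _ refl = true≢false Bx a∉B
  B-off-path Bx x≢b {suc m} m+1≤k refl with m≤n⇒m<n∨m≡n m+1≤k
  ... | inj₁ m+1<k = true≢false Bx (interior∉B (s≤s z≤n) m+1<k)
  ... | inj₂ refl  = x≢b refl

  B-no-path-edge : ∀ {x y} → B x ≡ true → x ≢ b → PE x y ≡ false
  B-no-path-edge {x} {y} Bx x≢b = by-cases (PE x y) (λ e → e) (λ e → ⊥-elim (on-path (PE-split e)))
    where
    on-path : (Σ ℕ λ m → m < k × ((x ≡ p[ m ] × y ≡ p[ suc m ]) ⊎ (y ≡ p[ m ] × x ≡ p[ suc m ]))) → ⊥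
    on-path (m , m<k , inj₁ (x≡ , _)) = B-off-path Bx x≢b (<⇒≤ m<k) x≡
    on-path (m , m<k , inj₂ (_ , x≡)) = B-off-path Bx x≢b m<k x≡

  B-closed : ∀ {x y} → B x ≡ true → x ≢ b → T x y ≡ true → B y ≡ true
  B-closed {y = y} Bx x≢b Txy = reach⇒B (reach-snoc (B⇒reach Bx) (H-intro Txy (B-no-path-edge {y = y} Bx x≢b)))

  N : Fin n → Bool
  N w = T b w ∧ not (w == c)

  N⊆B : ∀ {w} → N w ≡ true → B w ≡ true
  N⊆B {w} Nw with ∧-split Nw
  ... | Tbw , w≢c = reach⇒B (step (H-intro Tbw off-path) here)
    where
    off-path : PE b w ≡ false
    off-path = by-cases (PE b w) (λ e → e)
                 (λ e → ⊥-elim (true≢false (≡⇒== (PE-at-b {w} e)) (not-true w≢c)))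

  N-≢b : ∀ {w} → N w ≡ true → w ≢ b
  N-≢b Nw refl = true≢false (proj₁ (∧-split Nw)) (T-loopless b)

  N-intro : ∀ {x} → B x ≡ true → x ≢ b → T x b ≡ true → N x ≡ true
  N-intro {x} Bx x≢b Txb =
    ∧-intro (T-sym-edge Txb) (not-intro (≢⇒== (λ x≡c → true≢false (subst (λ w → B w ≡ true) x≡c Bx) c∉B)))

  ¬N⇒c : ∀ {y} → T b y ≡ true → N y ≡ false → y ≡ c
  ¬N⇒c Tby ¬Ny rewrite Tby = ==⇒≡ (not-false ¬Ny)

  N-path : ∀ {m} → m ≤ k → N p[ m ] ≡ false
  N-path {m} m≤k = by-cases (N p[ m ]) (λ e → e) (λ Nw → ⊥-elim (B-off-path (N⊆B Nw) (N-≢b Nw) m≤k refl))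

  -- b and a are not adjacent, since a ∉ B.
  T-b-a : T b a ≡ false
  T-b-a = by-cases (T b a) (λ e → e) (λ Tba → ⊥-elim (true≢false (reach⇒B (step (H-intro Tba off-path) here)) a∉B))
    where
    off-path : PE b a ≡ false
    off-path = by-cases (PE b a) (λ e → e)
                 (λ e → ⊥-elim (<-irrefl (p[]-injective z≤n (n≤1+n j) (PE-at-b {a} e)) 1≤j))

  S : Fin n → Bool
  S x = B x ∨ inPath k p x

  S-path : ∀ m → S p[ m ] ≡ true
  S-path m = ∨-introʳ (B p[ m ]) (inPath-path m)

  S-B : ∀ {x} → B x ≡ true → S x ≡ true
  S-B Bx = ∨-introˡ _ Bx

  a-neighbour : ∀ {y} → T a y ≡ true → S y ≡ true → y ≡ p[ 1 ]
  a-neighbour {y} Tay Sy with ∨-split {B y} Sy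
  ... | inj₁ By with y ≟ p[ 1 ]
  ...   | yes y≡p₁ = y≡p₁
  ...   | no  y≢p₁ = ⊥-elim (true≢false (B-closed By y≢b (T-sym-edge Tay)) a∉B)
    where
    y≢b : y ≢ b
    y≢b refl = true≢false Tay (trans (T-sym a b) T-b-a)
  a-neighbour {y} Tay Sy | inj₂ y∈P with inPath-split {y} y∈P
  ... | zero , _ , refl = ⊥-elim (true≢false Tay (T-loopless a))
  ... | suc zero , _ , y≡p₁ = y≡p₁
  ... | suc (suc m) , m+2≤k , refl with m≤n⇒m<n∨m≡n m+2≤k
  ...   | inj₂ refl = ⊥-elim (true≢false (trans (T-sym b a) Tay) T-b-a)
  ...   | inj₁ m+2<k with interior-neighbours m+2<k (T-sym-edge Tay)
  ...     | inj₁ a≡ = ⊥-elim (p[]≢a (s≤s z≤n) (≤-trans (n≤1+n _) m+2≤k) (sym a≡))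
  ...     | inj₂ a≡ = ⊥-elim (p[]≢a (s≤s z≤n) m+2<k (sym a≡))

  T' : Adj n
  T' = KC T a b c

  T'-as-stated : T' ≡ KC T a (p (fromℕ k)) (p (inject₁ (fromℕ j)))
  T'-as-stated = cong₂ (KC T a) (cong p (clamp-fromℕ k))
    (cong p (trans (cong (clamp k) (sym (toℕ-fromℕ j))) (clamp-inject₁ k (fromℕ j))))

  T'-split : ∀ {x y} → T' x y ≡ true →
    (T x y ≡ true × (x ≡ b → N y ≡ false) × (y ≡ b → N x ≡ false)) ⊎
    (x ≡ a × N y ≡ true) ⊎ (y ≡ a × N x ≡ true)
  T'-split {x} {y} e with ∨-split {T x y ∧ not (((x == b) ∧ N y) ∨ ((y == b) ∧ N x))} e
  ... | inj₁ kept with ∧-split kept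
  ...   | Txy , not-moved with ∨-false-split (not-true not-moved)
  ...     | x≢b , y≢b = inj₁ (Txy , guard-false⁻ x b x≢b , guard-false⁻ y b y≢b)
  T'-split {x} {y} e | inj₂ added with ∨-split {(x == a) ∧ N y} added
  ... | inj₁ at-x = inj₂ (inj₁ (guard-true x a at-x))
  ... | inj₂ at-y = inj₂ (inj₂ (guard-true y a at-y))

  T'-kept : ∀ {x y} → T x y ≡ true → (x ≡ b → N y ≡ false) → (y ≡ b → N x ≡ false) → T' x y ≡ true
  T'-kept {x} {y} Txy x≢b y≢b =
    ∨-introˡ (((x == a) ∧ N y) ∨ ((y == a) ∧ N x))
             (∧-intro Txy (not-intro (∨-false-intro (guard-false x b x≢b) (guard-false y b y≢b))))

  T'-added : ∀ {x y} → y ≡ a → N x ≡ true → T' x y ≡ true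
  T'-added {x} {y} y≡a Nx =
    ∨-introʳ (T x y ∧ not (((x == b) ∧ N y) ∨ ((y == b) ∧ N x)))
             (∨-introʳ ((x == a) ∧ N y) (∧-intro (≡⇒== y≡a) Nx))

  T'-added˘ : ∀ {x y} → x ≡ a → N y ≡ true → T' x y ≡ true
  T'-added˘ {x} {y} x≡a Ny =
    ∨-introʳ (T x y ∧ not (((x == b) ∧ N y) ∨ ((y == b) ∧ N x)))
             (∨-introˡ ((y == a) ∧ N x) (∧-intro (≡⇒== x≡a) Ny))

  X Y : Adj n
  X = induced T S
  Y = induced T' S

  induced-split : (G : Adj n) {x y : Fin n} → induced G S x y ≡ true →
    G x y ≡ true × S x ≡ true × S y ≡ true
  induced-split G {x} {y} e with ∧-split {G x y} e
  ... | Gxy , Sxy with ∧-split {S x} Sxy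
  ...   | Sx , Sy = Gxy , Sx , Sy

  induced-intro : (G : Adj n) {x y : Fin n} → G x y ≡ true → S x ≡ true → S y ≡ true →
    induced G S x y ≡ true
  induced-intro G Gxy Sx Sy = ∧-intro Gxy (∧-intro Sx Sy)

  distinct-around : ∀ {m} → suc m < k → p[ m ] ≢ p[ suc (suc m) ]
  distinct-around {m} m+1<k e with p[]-injective (≤-trans (n≤1+n m) (<⇒≤ m+1<k)) m+1<k e
  ... | ()

  X-interior : ∀ {m} → suc m < k → (f : Fin n → ℕ) →
    sumOver (X p[ suc m ]) f ≡ f p[ m ] + f p[ suc (suc m) ]
  X-interior m+1<k f = sumOver-pair f _ _ (distinct-around m+1<k)
    (induced-intro T (path-edge˘ (≤-trans (n≤1+n _) m+1<k)) (S-path _) (S-path _))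
    (induced-intro T (path-edge m+1<k) (S-path _) (S-path _))
    (λ y e → interior-neighbours m+1<k (proj₁ (induced-split T e)))

  Y-interior : ∀ {m} → suc m < k → (f : Fin n → ℕ) →
    sumOver (Y p[ suc m ]) f ≡ f p[ m ] + f p[ suc (suc m) ]
  Y-interior {m} m+1<k f = sumOver-pair f _ _ (distinct-around m+1<k)
    (induced-intro T' (T'-kept (path-edge˘ (≤-trans (n≤1+n _) m+1<k)) ≢b (λ _ → N-path m+1≤k)) (S-path _) (S-path _))
    (induced-intro T' (T'-kept (path-edge m+1<k) ≢b (λ _ → N-path m+1≤k)) (S-path _) (S-path _))
    only
    where
    m+1≤k = <⇒≤ m+1<k
    ≢b : ∀ {w} → p[ suc m ] ≡ b → N w ≡ false
    ≢b e = ⊥-elim (<-irrefl (p[]-injective m+1≤k ≤-refl e) m+1<k)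
    only : ∀ y → Y p[ suc m ] y ≡ true → y ≡ p[ m ] ⊎ y ≡ p[ suc (suc m) ]
    only y e with T'-split (proj₁ (induced-split T' e))
    ... | inj₁ (Txy , _ , _)       = interior-neighbours m+1<k Txy
    ... | inj₂ (inj₁ (x≡a , _))    = ⊥-elim (p[]≢a (s≤s z≤n) m+1≤k x≡a)
    ... | inj₂ (inj₂ (_ , Nx))     = ⊥-elim (true≢false Nx (N-path m+1≤k))

  X-a : (f : Fin n → ℕ) → sumOver (X a) f ≡ f p[ 1 ]
  X-a f = sumOver-singleton f p[ 1 ] (induced-intro T (path-edge (s≤s z≤n)) (S-path 0) (S-path 1))
    (λ y e → a-neighbour (proj₁ (induced-split T e)) (proj₂ (proj₂ (induced-split T e))))

  X-b : (f : Fin n → ℕ) → sumOver (X b) f ≡ f c + sumOver N f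
  X-b f = trans (sumOver-remove f c (induced-intro T (path-edge˘ ≤-refl) (S-path k) (S-path j)))
                (cong (λ t → f c + t) (sumOver-cong (λ y → bool-ext (to y) (from y)) (λ _ _ → refl)))
    where
    to : ∀ y → (X b ─ c) y ≡ true → N y ≡ true
    to y e = ∧-intro (proj₁ (induced-split T (proj₁ (∧-split e)))) (proj₂ (∧-split e))
    from : ∀ y → N y ≡ true → (X b ─ c) y ≡ true
    from y Ny = ∧-intro (induced-intro T (proj₁ (∧-split Ny)) (S-path k) (S-B (N⊆B Ny))) (proj₂ (∧-split Ny))

  Y-b : (f : Fin n → ℕ) → sumOver (Y b) f ≡ f c
  Y-b f = sumOver-singleton f c
    (induced-intro T' (T'-kept (path-edge˘ ≤-refl) (λ _ → N-path (n≤1+n j)) (λ _ → N-path ≤-refl))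
                   (S-path k) (S-path j))
    only
    where
    only : ∀ y → Y b y ≡ true → y ≡ c
    only y e with T'-split (proj₁ (induced-split T' e))
    ... | inj₁ (Tby , ¬N , _)   = ¬N⇒c Tby (¬N refl)
    ... | inj₂ (inj₁ (b≡a , _)) = ⊥-elim (a≢b (sym b≡a))
    ... | inj₂ (inj₂ (_ , Nb))  = ⊥-elim (true≢false Nb (N-path ≤-refl))

  Y-a : (f : Fin n → ℕ) → sumOver (Y a) f ≡ f p[ 1 ] + sumOver N f
  Y-a f = trans (sumOver-remove f p[ 1 ] p₁∈Y)
                (cong (λ t → f p[ 1 ] + t) (sumOver-cong (λ y → bool-ext (to y) (from y)) (λ _ _ → refl)))
    where
    p₁∈Y : Y a p[ 1 ] ≡ true
    p₁∈Y = induced-intro T' (T'-kept (path-edge (s≤s z≤n)) (λ a≡b → ⊥-elim (a≢b a≡b)) (λ _ → N-path z≤n))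
                        (S-path 0) (S-path 1)
    to : ∀ y → (Y a ─ p[ 1 ]) y ≡ true → N y ≡ true
    to y e with ∧-split e
    ... | Yay , y≢p₁ with induced-split T' Yay
    ...   | T'ay , _ , Sy with T'-split T'ay
    ...     | inj₁ (Tay , _ , _)  = ⊥-elim (true≢false (≡⇒== (a-neighbour Tay Sy)) (not-true y≢p₁))
    ...     | inj₂ (inj₁ (_ , Ny)) = Ny
    ...     | inj₂ (inj₂ (_ , Na)) = ⊥-elim (true≢false Na (N-path z≤n))
    from : ∀ y → N y ≡ true → (Y a ─ p[ 1 ]) y ≡ true
    from y Ny = ∧-intro (induced-intro T' (T'-added˘ refl Ny) (S-path 0) (S-B (N⊆B Ny)))
                        (not-intro (≢⇒== (B-off-path (N⊆B Ny) (N-≢b Ny) (s≤s z≤n))))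

  module Branch {x : Fin n} (Bx : B x ≡ true) (x≢b : x ≢ b) where

    X-branch : ∀ y → X x y ≡ T x y
    X-branch y = bool-ext (λ e → proj₁ (induced-split T e))
                          (λ Txy → induced-intro T Txy (S-B Bx) (S-B (B-closed Bx x≢b Txy)))

    Y-branch : N x ≡ false → ∀ y → Y x y ≡ T x y
    Y-branch ¬Nx y = bool-ext to
      (λ Txy → induced-intro T' (T'-kept Txy (λ x≡b → ⊥-elim (x≢b x≡b)) (λ _ → ¬Nx))
                             (S-B Bx) (S-B (B-closed Bx x≢b Txy)))
      where
      to : Y x y ≡ true → T x y ≡ true
      to e with T'-split (proj₁ (induced-split T' e))
      ... | inj₁ (Txy , _ , _)    = Txy
      ... | inj₂ (inj₁ (x≡a , _)) = ⊥-elim (B-off-path Bx x≢b z≤n x≡a)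
      ... | inj₂ (inj₂ (_ , Nx))  = ⊥-elim (true≢false Nx ¬Nx)

    module Moved (Nx : N x ≡ true) where

      b∈X : X x b ≡ true
      b∈X = induced-intro T (T-sym-edge (proj₁ (∧-split Nx))) (S-B Bx) (S-path k)

      a∈Y : Y x a ≡ true
      a∈Y = induced-intro T' (T'-added refl Nx) (S-B Bx) (S-path 0)

      X∖b≡Y∖a : ∀ y → (X x ─ b) y ≡ (Y x ─ a) y
      X∖b≡Y∖a y = bool-ext from to
        where
        to : (Y x ─ a) y ≡ true → (X x ─ b) y ≡ true
        to e with ∧-split e
        ... | Yxy , y≢a with induced-split T' Yxy
        ...   | T'xy , Sx , Sy with T'-split T'xy
        ...     | inj₁ (Txy , _ , ¬N) = ∧-intro (induced-intro T Txy Sx Sy)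
                                                (not-intro (≢⇒== (λ y≡b → true≢false Nx (¬N y≡b))))
        ...     | inj₂ (inj₁ (x≡a , _)) = ⊥-elim (B-off-path Bx x≢b z≤n x≡a)
        ...     | inj₂ (inj₂ (y≡a , _)) = ⊥-elim (true≢false (≡⇒== y≡a) (not-true y≢a))
        from : (X x ─ b) y ≡ true → (Y x ─ a) y ≡ true
        from e with ∧-split e
        ... | Xxy , y≢b with induced-split T Xxy
        ...   | Txy , Sx , Sy =
          ∧-intro (induced-intro T' (T'-kept Txy (λ x≡b → ⊥-elim (x≢b x≡b))
                                       (λ y≡b → ⊥-elim (true≢false (≡⇒== y≡b) (not-true y≢b)))) Sx Sy)
                  (not-intro (≢⇒== (λ y≡a → true≢false (subst (λ w → B w ≡ true) y≡a (B-closed Bx x≢b Txy)) a∉B)))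

  ωX ωY : ℕ → Fin n → ℕ
  ωX ℓ y = ω ℓ y X
  ωY ℓ y = ω ℓ y Y

  -- Reversing the path and fixing B ∖ {b} carries X onto Y; on walk counts:
  Mirror : ℕ → Set
  Mirror ℓ = (∀ {x} → B x ≡ true → x ≢ b → ωX ℓ x ≡ ωY ℓ x) ×
             (∀ i i' → i + i' ≡ k → ωX ℓ p[ i ] ≡ ωY ℓ p[ i' ])

  mirror-step-branch : ∀ {ℓ} → Mirror ℓ → ∀ {x} → B x ≡ true → x ≢ b →
    ωX (suc ℓ) x ≡ ωY (suc ℓ) x
  mirror-step-branch {ℓ} (on-B , on-P) {x} Bx x≢b = by-cases (N x) unmoved moved
    where
    open Branch Bx x≢b
    unmoved : N x ≡ false → ωX (suc ℓ) x ≡ ωY (suc ℓ) x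
    unmoved ¬Nx = sumOver-cong (λ y → trans (X-branch y) (sym (Y-branch ¬Nx y)))
      (λ y Xxy → let Txy = proj₁ (induced-split T Xxy) in
         on-B (B-closed Bx x≢b Txy)
              (λ y≡b → true≢false (N-intro Bx x≢b (subst (λ w → T x w ≡ true) y≡b Txy)) ¬Nx))
    moved : N x ≡ true → ωX (suc ℓ) x ≡ ωY (suc ℓ) x
    moved Nx = begin
      ωX (suc ℓ) x                          ≡⟨ sumOver-remove (ωX ℓ) b b∈X ⟩
      ωX ℓ b + sumOver (X x ─ b) (ωX ℓ)     ≡⟨ cong₂ _+_ (on-P k 0 (+-identityʳ k))
                                                 (sumOver-cong X∖b≡Y∖a on-rest) ⟩
      ωY ℓ a + sumOver (Y x ─ a) (ωY ℓ)     ≡⟨ sym (sumOver-remove (ωY ℓ) a a∈Y) ⟩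
      ωY (suc ℓ) x                          ∎
      where
      open ≡-Reasoning
      open Moved Nx
      on-rest : ∀ y → (X x ─ b) y ≡ true → ωX ℓ y ≡ ωY ℓ y
      on-rest y e = on-B (B-closed Bx x≢b (proj₁ (induced-split T (proj₁ (∧-split e)))))
                         (λ y≡b → true≢false (≡⇒== y≡b) (not-true (proj₂ (∧-split e))))

  mirror-step-path : ∀ {ℓ} → Mirror ℓ → ∀ i i' → i + i' ≡ k → ωX (suc ℓ) p[ i ] ≡ ωY (suc ℓ) p[ i' ]
  mirror-step-path {ℓ} (on-B , on-P) zero _ refl = begin
    ωX (suc ℓ) a   ≡⟨ X-a (ωX ℓ) ⟩
    ωX ℓ p[ 1 ]    ≡⟨ on-P 1 j refl ⟩
    ωY ℓ c         ≡⟨ sym (Y-b (ωY ℓ)) ⟩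
    ωY (suc ℓ) b   ∎
    where open ≡-Reasoning
  mirror-step-path {ℓ} (on-B , on-P) (suc u) zero u+1≡k
    with trans (sym (+-identityʳ (suc u))) u+1≡k
  ... | refl = begin
    ωX (suc ℓ) b                     ≡⟨ X-b (ωX ℓ) ⟩
    ωX ℓ c + sumOver N (ωX ℓ)        ≡⟨ cong₂ _+_ (on-P j 1 (+-comm j 1))
                                          (sumOver-cong {S = N} (λ _ → refl) (λ _ Nw → on-B (N⊆B Nw) (N-≢b Nw))) ⟩
    ωY ℓ p[ 1 ] + sumOver N (ωY ℓ)   ≡⟨ sym (Y-a (ωY ℓ)) ⟩
    ωY (suc ℓ) a                     ∎
    where open ≡-Reasoning
  mirror-step-path {ℓ} (_ , on-P) (suc u) (suc v) e = begin
    ωX (suc ℓ) p[ suc u ]                      ≡⟨ X-interior (interior u v e) (ωX ℓ) ⟩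
    ωX ℓ p[ u ] + ωX ℓ p[ suc (suc u) ]        ≡⟨ cong₂ _+_ (on-P u (suc (suc v)) (trans (+-suc u (suc v)) e))
                                                            (on-P (suc (suc u)) v (trans (sym (+-suc (suc u) v)) e)) ⟩
    ωY ℓ p[ suc (suc v) ] + ωY ℓ p[ v ]        ≡⟨ +-comm (ωY ℓ p[ suc (suc v) ]) (ωY ℓ p[ v ]) ⟩
    ωY ℓ p[ v ] + ωY ℓ p[ suc (suc v) ]        ≡⟨ sym (Y-interior (interior v u (trans (+-comm (suc v) (suc u)) e)) (ωY ℓ)) ⟩
    ωY (suc ℓ) p[ suc v ]                      ∎
    where
    open ≡-Reasoning
    interior : ∀ u v → suc u + suc v ≡ k → suc u < k
    interior u v e = subst (suc (suc u) ≤_) e (s≤s (subst (suc u ≤_) (sym (+-suc u v)) (s≤s (m≤m+n u v))))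

  mirror : ∀ ℓ → Mirror ℓ
  mirror zero    = (λ _ _ → refl) , (λ _ _ _ → refl)
  mirror (suc ℓ) = mirror-step-branch {ℓ} (mirror ℓ) , mirror-step-path {ℓ} (mirror ℓ)

  module Even (q : ℕ) (k≡q+q : k ≡ q + q) where

    1≤q : 1 ≤ q
    1≤q = half-positive q k≡q+q
      where
      half-positive : ∀ q → k ≡ q + q → 1 ≤ q
      half-positive (suc _) _ = s≤s z≤n

    first-half-interior : ∀ {i} → suc i ≤ q → suc i < k
    first-half-interior {i} i+1≤q =
      subst (suc (suc i) ≤_) (sym k≡q+q) (≤-trans (s≤s i+1≤q) (m<m+n q 1≤q))

    ωX≤ωY : ∀ ℓ i → i ≤ q → ωX ℓ p[ i ] ≤ ωY ℓ p[ i ]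
    ωX≤ωY zero    i       _ = ≤-refl
    ωX≤ωY (suc ℓ) zero    _ = begin
      ωX (suc ℓ) a                       ≡⟨ X-a (ωX ℓ) ⟩
      ωX ℓ p[ 1 ]                        ≤⟨ ωX≤ωY ℓ 1 1≤q ⟩
      ωY ℓ p[ 1 ]                        ≤⟨ m≤m+n _ _ ⟩
      ωY ℓ p[ 1 ] + sumOver N (ωY ℓ)     ≡⟨ sym (Y-a (ωY ℓ)) ⟩
      ωY (suc ℓ) a                       ∎
      where open ≤-Reasoning
    ωX≤ωY (suc ℓ) (suc u) u+1≤q with m≤n⇒m<n∨m≡n u+1≤q
    ... | inj₂ refl = ≤-reflexive (proj₂ (mirror (suc ℓ)) q q (sym k≡q+q))
    ... | inj₁ u+2≤q = begin
      ωX (suc ℓ) p[ suc u ]                     ≡⟨ X-interior (first-half-interior u+1≤q) (ωX ℓ) ⟩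
      ωX ℓ p[ u ] + ωX ℓ p[ suc (suc u) ]       ≤⟨ +-mono-≤ (ωX≤ωY ℓ u (≤-trans (n≤1+n u) u+1≤q))
                                                            (ωX≤ωY ℓ (suc (suc u)) u+2≤q) ⟩
      ωY ℓ p[ u ] + ωY ℓ p[ suc (suc u) ]       ≡⟨ sym (Y-interior (first-half-interior u+1≤q) (ωY ℓ)) ⟩
      ωY (suc ℓ) p[ suc u ]                     ∎
      where open ≤-Reasoning

    walks-from-p₀ : ∀ ℓ →
      ω ℓ (p zero) (induced T S) ≤ ω ℓ (p zero) (induced (KC T a (p (fromℕ k)) (p (inject₁ (fromℕ j)))) S)
    walks-from-p₀ ℓ = subst (λ G → ωX ℓ a ≤ ω ℓ a (induced G S)) T'-as-stated (ωX≤ωY ℓ 0 z≤n)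

corollary3 : ∀ {n} (T : Adj n) → IsTree T →
    (j : ℕ) (p : Fin (suc (suc j)) → Fin n) → IsPath T (suc j) p →
    (∀ (i : Fin (suc (suc j))) → 1 ≤ toℕ i → toℕ i < suc j → deg T (p i) ≡ 2) →
    (B : Fin n → Bool) →
    (∀ x → (B x ≡ true) ⇔ Reach (deleteEdges T (pathEdge (suc j) p)) (p (fromℕ (suc j))) x) →
    2 ∣ suc j →
    ∀ (ℓ : ℕ) → 1 ≤ ℓ →
    (+ ω ℓ (p zero) (induced T (λ x → B x ∨ inPath (suc j) p x))
       - + ω ℓ (p zero) (pathEdge (suc j) p))
    ≤ℤ
    (+ ω ℓ (p zero)
         (induced (KC T (p zero) (p (fromℕ (suc j))) (p (inject₁ (fromℕ j))))
                  (λ x → B x ∨ inPath (suc j) p x))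
       - + ω ℓ (p zero) (pathEdge (suc j) p))
corollary3 T tree zero p isPath interior-deg B B-def 2∣1 ℓ _ with ∣1⇒≡1 2∣1
... | ()
corollary3 T tree (suc j) p isPath interior-deg B B-def (divides q k≡q*2) ℓ _ =
  ℤ.+-monoˡ-≤ (- (+ ω ℓ (p zero) (pathEdge (suc (suc j)) p))) (+≤+ (walks-from-p₀ ℓ))
  where
  open Configuration T tree (suc j) p isPath interior-deg B B-def (s≤s z≤n)
  open Even q (trans k≡q*2 (trans (*-comm q 2) (cong (λ t → q + t) (+-identityʳ q))))
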